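{- Over $\mathsf{RCA}_0$, $\mathsf{MM}$ implies $\mathsf{MIM}$.
   Context: Graphs are countable simple graphs $G=(V,E)$ with $V\subseteq\mathbb{N}$, formalized in second-order arithmetic. A matching is $M\subseteq E$ with no vertex incident to two edges of $M$; its support $V(M)$ is the set of covered vertices. A path is an injective finite or infinite sequence of vertices with consecutive vertices adjacent. For a matching $M$, an $M$-augmenting path is a path whose edges alternately lie in $M$ and $E\setminus M$, which starts at a vertex not in $V(M)$, and which is either infinite or ends at a vertex not in $V(M)$; it is proper if it passes through an edge of $M$. A matching $M$ is independent if there is no proper $M$-augmenting path starting at a vertex of $V\setminus V(M)$. $\mathsf{MM}$: for every graph $G$ there is a matching $M$ such that $V(M)$ is not properly contained in the support of any other matching of $G$. $\mathsf{MIM}$: for every graph $G$ there is an independent matching $M$ such that $V(M)$ is not properly contained in the support of any other independent matching of $G$. -}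

module Defs where

open import Data.Nat using (ℕ; suc)
open import Data.Fin using (Fin)
open import Data.Vec using (Vec; _∷_; lookup)
open import Data.Product using (Σ; _×_; _,_)
open import Data.Sum using (_⊎_)
open import Relation.Nullary using (¬_)
open import Relation.Binary.PropositionalEquality using (_≡_; _≢_)

infix 2 _↔_
_↔_ : Set → Set → Set
A ↔ B = (A → B) × (B → A)

-- A structure for the language L₂ of second-order arithmetic
-- (number sort, set sort, 0, 1, +, ·, <, ∈); equality on numbers is ≡.
record Structure : Set₁ where
  field
    Num Sets : Set
    𝟘 𝟙 : Num
    _⊕_ _⊗_ : Num → Num → Num
    _≺_ : Num → Num → Set
    _∈_ : Num → Sets → Set

data Term (n : ℕ) : Set where
  var : Fin n → Term n
  `0 `1 : Term n
  _`+_ _`*_ : Term n → Term n → Term n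

data Δ₀ (n m : ℕ) : Set where
  _`=_ _`<_ : Term n → Term n → Δ₀ n m
  _`∈_ : Term n → Fin m → Δ₀ n m
  `¬_ : Δ₀ n m → Δ₀ n m
  _`∧_ _`∨_ _`⇒_ : Δ₀ n m → Δ₀ n m → Δ₀ n m
  -- ∀ x < t. φ and ∃ x < t. φ  (x is the new variable 0; t does not mention x)
  `∀<_∙_ `∃<_∙_ : Term n → Δ₀ (suc n) m → Δ₀ n m

-- Σ⁰₁ formula ∃ w. θ and Π⁰₁ formula ∀ w. θ, θ bounded, w = variable 0.
Σ⁰₁ : ℕ → ℕ → Set
Σ⁰₁ n m = Δ₀ (suc n) m

Π⁰₁ : ℕ → ℕ → Set
Π⁰₁ n m = Δ₀ (suc n) m

module Semantics (𝔐 : Structure) where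
  open Structure 𝔐

  ⟦_⟧t : ∀ {n} → Term n → Vec Num n → Num
  ⟦ var i ⟧t ρ = lookup ρ i
  ⟦ `0 ⟧t ρ = 𝟘
  ⟦ `1 ⟧t ρ = 𝟙
  ⟦ s `+ t ⟧t ρ = ⟦ s ⟧t ρ ⊕ ⟦ t ⟧t ρ
  ⟦ s `* t ⟧t ρ = ⟦ s ⟧t ρ ⊗ ⟦ t ⟧t ρ

  ⟦_⟧ : ∀ {n m} → Δ₀ n m → Vec Num n → Vec Sets m → Set
  ⟦ s `= t ⟧ ρ σ = ⟦ s ⟧t ρ ≡ ⟦ t ⟧t ρ
  ⟦ s `< t ⟧ ρ σ = ⟦ s ⟧t ρ ≺ ⟦ t ⟧t ρ
  ⟦ t `∈ X ⟧ ρ σ = ⟦ t ⟧t ρ ∈ lookup σ X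
  ⟦ `¬ φ ⟧ ρ σ = ¬ ⟦ φ ⟧ ρ σ
  ⟦ φ `∧ ψ ⟧ ρ σ = ⟦ φ ⟧ ρ σ × ⟦ ψ ⟧ ρ σ
  ⟦ φ `∨ ψ ⟧ ρ σ = ⟦ φ ⟧ ρ σ ⊎ ⟦ ψ ⟧ ρ σ
  ⟦ φ `⇒ ψ ⟧ ρ σ = ⟦ φ ⟧ ρ σ → ⟦ ψ ⟧ ρ σ
  ⟦ `∀< t ∙ φ ⟧ ρ σ = (x : Num) → x ≺ ⟦ t ⟧t ρ → ⟦ φ ⟧ (x ∷ ρ) σ
  ⟦ `∃< t ∙ φ ⟧ ρ σ = Σ Num λ x → x ≺ ⟦ t ⟧t ρ × ⟦ φ ⟧ (x ∷ ρ) σ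

  ⟦_⟧Σ : ∀ {n m} → Σ⁰₁ n m → Vec Num n → Vec Sets m → Set
  ⟦ φ ⟧Σ ρ σ = Σ Num λ w → ⟦ φ ⟧ (w ∷ ρ) σ

  ⟦_⟧Π : ∀ {n m} → Π⁰₁ n m → Vec Num n → Vec Sets m → Set
  ⟦ φ ⟧Π ρ σ = (w : Num) → ⟦ φ ⟧ (w ∷ ρ) σ

  record IsRCA₀ : Set where
    field
      succ≢0   : ∀ a → (a ⊕ 𝟙) ≢ 𝟘
      succ-inj : ∀ a b → a ⊕ 𝟙 ≡ b ⊕ 𝟙 → a ≡ b
      +-zero   : ∀ a → a ⊕ 𝟘 ≡ a
      +-suc    : ∀ a b → a ⊕ (b ⊕ 𝟙) ≡ (a ⊕ b) ⊕ 𝟙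
      *-zero   : ∀ a → a ⊗ 𝟘 ≡ 𝟘
      *-suc    : ∀ a b → a ⊗ (b ⊕ 𝟙) ≡ (a ⊗ b) ⊕ a
      ≮0       : ∀ a → ¬ (a ≺ 𝟘)
      <-suc    : ∀ a b → (a ≺ (b ⊕ 𝟙)) ↔ (a ≺ b ⊎ a ≡ b)
      Σ⁰₁-IND  : ∀ {n m} (φ : Σ⁰₁ (suc n) m) (ρ : Vec Num n) (σ : Vec Sets m) →
                 ⟦ φ ⟧Σ (𝟘 ∷ ρ) σ →
                 (∀ x → ⟦ φ ⟧Σ (x ∷ ρ) σ → ⟦ φ ⟧Σ ((x ⊕ 𝟙) ∷ ρ) σ) →
                 ∀ x → ⟦ φ ⟧Σ (x ∷ ρ) σ
      Δ⁰₁-CA   : ∀ {n m} (φ : Σ⁰₁ (suc n) m) (ψ : Π⁰₁ (suc n) m)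
                 (ρ : Vec Num n) (σ : Vec Sets m) →
                 (∀ x → ⟦ φ ⟧Σ (x ∷ ρ) σ ↔ ⟦ ψ ⟧Π (x ∷ ρ) σ) →
                 Σ Sets λ X → ∀ x → (x ∈ X) ↔ ⟦ φ ⟧Σ (x ∷ ρ) σ

  ⟨_,_⟩ : Num → Num → Num
  ⟨ i , j ⟩ = ((i ⊕ j) ⊗ (i ⊕ j)) ⊕ i

  -- A graph G = (V, E): E is a set of codes of ordered pairs, symmetric,
  -- irreflexive, with both endpoints in V; {x,y} is an edge iff ⟨x,y⟩ ∈ E.
  IsGraph : Sets → Sets → Set
  IsGraph V E =
    (∀ z → z ∈ E → Σ Num λ x → Σ Num λ y →
        z ≡ ⟨ x , y ⟩ × x ∈ V × y ∈ V × x ≢ y) ×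
    (∀ x y → ⟨ x , y ⟩ ∈ E → ⟨ y , x ⟩ ∈ E)

  IsMatching : Sets → Sets → Set
  IsMatching E M =
    (∀ z → z ∈ M → z ∈ E) ×
    (∀ x y → ⟨ x , y ⟩ ∈ M → ⟨ y , x ⟩ ∈ M) ×
    (∀ x y y′ → ⟨ x , y ⟩ ∈ M → ⟨ x , y′ ⟩ ∈ M → y ≡ y′)

  Covered : Sets → Num → Set
  Covered M x = Σ Num λ y → ⟨ x , y ⟩ ∈ M

  _⊊ᵥ_ : Sets → Sets → Set
  M ⊊ᵥ M′ = (∀ x → Covered M x → Covered M′ x) ×
            Σ Num λ x → Covered M′ x × ¬ Covered M x

  -- A path (finite or infinite) coded by a set P of pairs ⟨i, vᵢ⟩:
  -- a function on an initial segment of ℕ containing 0, injective,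
  -- with values in V and consecutive values adjacent.
  IsPath : Sets → Sets → Sets → Set
  IsPath V E P =
    (Σ Num λ v → ⟨ 𝟘 , v ⟩ ∈ P) ×
    (∀ i v w → ⟨ i , v ⟩ ∈ P → ⟨ i , w ⟩ ∈ P → v ≡ w) ×
    (∀ i v → ⟨ i ⊕ 𝟙 , v ⟩ ∈ P → Σ Num λ w → ⟨ i , w ⟩ ∈ P) ×
    (∀ i j v → ⟨ i , v ⟩ ∈ P → ⟨ j , v ⟩ ∈ P → i ≡ j) ×
    (∀ i v → ⟨ i , v ⟩ ∈ P → v ∈ V) ×
    (∀ i v w → ⟨ i , v ⟩ ∈ P → ⟨ i ⊕ 𝟙 , w ⟩ ∈ P → ⟨ v , w ⟩ ∈ E)

  IsAugmenting : Sets → Sets → Set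
  IsAugmenting M P =
    (∀ v → ⟨ 𝟘 , v ⟩ ∈ P → ¬ Covered M v) ×
    (∀ i u v w → ⟨ i , u ⟩ ∈ P → ⟨ i ⊕ 𝟙 , v ⟩ ∈ P → ⟨ (i ⊕ 𝟙) ⊕ 𝟙 , w ⟩ ∈ P →
        (⟨ u , v ⟩ ∈ M) ↔ (¬ (⟨ v , w ⟩ ∈ M))) ×
    ((∀ i → Σ Num λ v → ⟨ i , v ⟩ ∈ P) ⊎
     (Σ Num λ k → Σ Num λ v → ⟨ k , v ⟩ ∈ P ×
        ¬ (Σ Num λ w → ⟨ k ⊕ 𝟙 , w ⟩ ∈ P) × ¬ Covered M v))

  IsProper : Sets → Sets → Set
  IsProper M P = Σ Num λ i → Σ Num λ u → Σ Num λ v →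
    ⟨ i , u ⟩ ∈ P × ⟨ i ⊕ 𝟙 , v ⟩ ∈ P × ⟨ u , v ⟩ ∈ M

  IsIndependent : Sets → Sets → Sets → Set
  IsIndependent V E M =
    ¬ (Σ Sets λ P → IsPath V E P × IsAugmenting M P × IsProper M P ×
         (∀ v → ⟨ 𝟘 , v ⟩ ∈ P → v ∈ V × ¬ Covered M v))

  MM : Set
  MM = ∀ V E → IsGraph V E →
    Σ Sets λ M → IsMatching E M ×
      ¬ (Σ Sets λ M′ → IsMatching E M′ × M ⊊ᵥ M′)

  MIM : Set
  MIM = ∀ V E → IsGraph V E →
    Σ Sets λ M → IsMatching E M × IsIndependent V E M ×
      ¬ (Σ Sets λ M′ → IsMatching E M′ × IsIndependent V E M′ × M ⊊ᵥ M′)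

-- By MM take a maximal matching M; it is a fortiori maximal among independent matchings, so it
-- suffices that M is independent. If P were a proper M-augmenting path, the edges of P outside M
-- together with the edges of M off P would form a matching covering V(M) and the first vertex of P,
-- contradicting maximality. Forming it needs the vertex set of P, which is only Σ⁰₁; MM provides it:
-- give every u an edge A u — B u and a pendant edge at A u and at B u for each position of u on P.
-- A maximal matching then contains A u — B u exactly when u is not on P.

module Submission where

open import Defs
open import Level using (0ℓ)
open import Data.Nat using (ℕ; zero; suc)
import Data.Nat as ℕ
open import Data.Fin using (Fin; #_; punchIn)
open import Data.Vec using (Vec; []; _∷_; insertAt; lookup)
open import Data.Vec.Properties using (insertAt-punchIn)
open import Data.Product using (Σ; _×_; _,_; proj₁; proj₂)
import Data.Product as Product
import Data.Sum as Sum
open import Data.Sum using (_⊎_; inj₁; inj₂)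
open import Data.Empty using (⊥-elim)
open import Function using (id; _∘_)
open import Relation.Nullary using (¬_; yes; no)
open import Axiom.ExcludedMiddle using (ExcludedMiddle)
open import Relation.Nullary.Decidable using (True; False; toWitnessFalse)
open import Relation.Binary.PropositionalEquality
open import Algebra.Bundles using (CommutativeSemiring)
open import Algebra.Structures.Biased using (isCommutativeSemiringˡ)
import Algebra.Solver.Ring.NaturalCoefficients.Default as Solver

-- Bounded formulas: weakening, Δ₀ induction and comprehension

v : ∀ {n} (k : ℕ) {k<n : True (k ℕ.<? n)} → Term n
v k {k<n} = var (#_ k {m<n = k<n})

⟨_,_⟩ᵗ : ∀ {n} → Term n → Term n → Term n
⟨ s , t ⟩ᵗ = ((s `+ t) `* (s `+ t)) `+ s

weakenᵗ : ∀ {n} → Fin (suc n) → Term n → Term (suc n)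
weakenᵗ k (var i) = var (punchIn k i)
weakenᵗ k `0 = `0
weakenᵗ k `1 = `1
weakenᵗ k (s `+ t) = weakenᵗ k s `+ weakenᵗ k t
weakenᵗ k (s `* t) = weakenᵗ k s `* weakenᵗ k t

weaken : ∀ {n m} → Fin (suc n) → Δ₀ n m → Δ₀ (suc n) m
weaken k (s `= t) = weakenᵗ k s `= weakenᵗ k t
weaken k (s `< t) = weakenᵗ k s `< weakenᵗ k t
weaken k (t `∈ X) = weakenᵗ k t `∈ X
weaken k (`¬ φ) = `¬ weaken k φ
weaken k (φ `∧ ψ) = weaken k φ `∧ weaken k ψ
weaken k (φ `∨ ψ) = weaken k φ `∨ weaken k ψ
weaken k (φ `⇒ ψ) = weaken k φ `⇒ weaken k ψ
weaken k (`∀< t ∙ φ) = `∀< weakenᵗ k t ∙ weaken (Fin.suc k) φ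
weaken k (`∃< t ∙ φ) = `∃< weakenᵗ k t ∙ weaken (Fin.suc k) φ

module _ {𝔐 : Structure} (rca : Semantics.IsRCA₀ 𝔐) where
  open Structure 𝔐
  open Semantics 𝔐
  open IsRCA₀ rca

  ⟦weakenᵗ⟧ : ∀ {n} (k : Fin (suc n)) (t : Term n) (ρ : Vec Num n) (w : Num) →
              ⟦ weakenᵗ k t ⟧t (insertAt ρ k w) ≡ ⟦ t ⟧t ρ
  ⟦weakenᵗ⟧ k (var i) ρ w = insertAt-punchIn ρ k w i
  ⟦weakenᵗ⟧ k `0 ρ w = refl
  ⟦weakenᵗ⟧ k `1 ρ w = refl
  ⟦weakenᵗ⟧ k (s `+ t) ρ w = cong₂ _⊕_ (⟦weakenᵗ⟧ k s ρ w) (⟦weakenᵗ⟧ k t ρ w)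
  ⟦weakenᵗ⟧ k (s `* t) ρ w = cong₂ _⊗_ (⟦weakenᵗ⟧ k s ρ w) (⟦weakenᵗ⟧ k t ρ w)

  ⟦weaken⟧ : ∀ {n m} (k : Fin (suc n)) (φ : Δ₀ n m) (ρ : Vec Num n) (σ : Vec Sets m) (w : Num) →
             ⟦ weaken k φ ⟧ (insertAt ρ k w) σ ↔ ⟦ φ ⟧ ρ σ
  ⟦weaken⟧ k (s `= t) ρ σ w rewrite ⟦weakenᵗ⟧ k s ρ w | ⟦weakenᵗ⟧ k t ρ w = id , id
  ⟦weaken⟧ k (s `< t) ρ σ w rewrite ⟦weakenᵗ⟧ k s ρ w | ⟦weakenᵗ⟧ k t ρ w = id , id
  ⟦weaken⟧ k (t `∈ X) ρ σ w rewrite ⟦weakenᵗ⟧ k t ρ w = id , id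
  ⟦weaken⟧ k (`¬ φ) ρ σ w = let (f , g) = ⟦weaken⟧ k φ ρ σ w in (_∘ g) , (_∘ f)
  ⟦weaken⟧ k (φ `∧ ψ) ρ σ w =
    let (f , g) = ⟦weaken⟧ k φ ρ σ w ; (f′ , g′) = ⟦weaken⟧ k ψ ρ σ w
    in Product.map f f′ , Product.map g g′
  ⟦weaken⟧ k (φ `∨ ψ) ρ σ w =
    let (f , g) = ⟦weaken⟧ k φ ρ σ w ; (f′ , g′) = ⟦weaken⟧ k ψ ρ σ w
    in Sum.map f f′ , Sum.map g g′
  ⟦weaken⟧ k (φ `⇒ ψ) ρ σ w =
    let (f , g) = ⟦weaken⟧ k φ ρ σ w ; (f′ , g′) = ⟦weaken⟧ k ψ ρ σ w
    in (λ h → f′ ∘ h ∘ g) , (λ h → g′ ∘ h ∘ f)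
  ⟦weaken⟧ k (`∀< t ∙ φ) ρ σ w rewrite ⟦weakenᵗ⟧ k t ρ w =
    (λ h x x≺ → proj₁ (⟦weaken⟧ (Fin.suc k) φ (x ∷ ρ) σ w) (h x x≺)) ,
    (λ h x x≺ → proj₂ (⟦weaken⟧ (Fin.suc k) φ (x ∷ ρ) σ w) (h x x≺))
  ⟦weaken⟧ k (`∃< t ∙ φ) ρ σ w rewrite ⟦weakenᵗ⟧ k t ρ w =
    (λ (x , x≺ , h) → x , x≺ , proj₁ (⟦weaken⟧ (Fin.suc k) φ (x ∷ ρ) σ w) h) ,
    (λ (x , x≺ , h) → x , x≺ , proj₂ (⟦weaken⟧ (Fin.suc k) φ (x ∷ ρ) σ w) h)

  ⟦weaken₀⟧ : ∀ {n m} (φ : Δ₀ n m) {ρ : Vec Num n} {σ : Vec Sets m} {w : Num} →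
              ⟦ weaken Fin.zero φ ⟧ (w ∷ ρ) σ ↔ ⟦ φ ⟧ ρ σ
  ⟦weaken₀⟧ φ {ρ} {σ} {w} = ⟦weaken⟧ Fin.zero φ ρ σ w

  -- Opaque, like projection below: with-abstraction over the sets these produce would otherwise
  -- unfold their proofs, which is prohibitively slow.
  opaque
    Δ₀-IND : ∀ {n m} (φ : Δ₀ (suc n) m) (ρ : Vec Num n) (σ : Vec Sets m) →
             ⟦ φ ⟧ (𝟘 ∷ ρ) σ → (∀ x → ⟦ φ ⟧ (x ∷ ρ) σ → ⟦ φ ⟧ ((x ⊕ 𝟙) ∷ ρ) σ) →
             ∀ x → ⟦ φ ⟧ (x ∷ ρ) σ
    Δ₀-IND φ ρ σ base step x = proj₁ (⟦weaken₀⟧ φ) (proj₂ (Σ⁰₁-IND (weaken Fin.zero φ) ρ σ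
      (𝟘 , proj₂ (⟦weaken₀⟧ φ) base)
      (λ y (_ , h) → 𝟘 , proj₂ (⟦weaken₀⟧ φ) (step y (proj₁ (⟦weaken₀⟧ φ) h))) x))

    Δ₀-CA : ∀ {n m} (φ : Δ₀ (suc n) m) (ρ : Vec Num n) (σ : Vec Sets m) →
            Σ Sets λ X → ∀ x → (x ∈ X) ↔ ⟦ φ ⟧ (x ∷ ρ) σ
    Δ₀-CA φ ρ σ with Δ⁰₁-CA (weaken Fin.zero φ) (weaken Fin.zero φ) ρ σ Σ↔Π
      where
      Σ↔Π : ∀ x → ⟦ weaken Fin.zero φ ⟧Σ (x ∷ ρ) σ ↔ ⟦ weaken Fin.zero φ ⟧Π (x ∷ ρ) σ
      Σ↔Π x = (λ (_ , h) _ → proj₂ (⟦weaken₀⟧ φ) (proj₁ (⟦weaken₀⟧ φ) h)) , λ h → 𝟘 , h 𝟘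
    ... | X , X↔ = X , λ x → proj₁ (⟦weaken₀⟧ φ) ∘ proj₂ ∘ proj₁ (X↔ x) ,
                             λ h → proj₂ (X↔ x) (𝟘 , proj₂ (⟦weaken₀⟧ φ) h)

  -- Arithmetic in a model of RCA₀

  +-identityˡ : ∀ a → 𝟘 ⊕ a ≡ a
  +-identityˡ = Δ₀-IND ((`0 `+ v 0) `= v 0) [] []
    (+-zero 𝟘) (λ a h → trans (+-suc 𝟘 a) (cong (_⊕ 𝟙) h))

  +-sucˡ : ∀ a b → (a ⊕ 𝟙) ⊕ b ≡ (a ⊕ b) ⊕ 𝟙
  +-sucˡ a = Δ₀-IND (((v 1 `+ `1) `+ v 0) `= ((v 1 `+ v 0) `+ `1)) (a ∷ []) []
    (trans (+-zero _) (cong (_⊕ 𝟙) (sym (+-zero a))))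
    (λ b h → trans (+-suc _ b) (trans (cong (_⊕ 𝟙) h) (cong (_⊕ 𝟙) (sym (+-suc a b)))))

  +-comm : ∀ a b → a ⊕ b ≡ b ⊕ a
  +-comm a = Δ₀-IND ((v 1 `+ v 0) `= (v 0 `+ v 1)) (a ∷ []) []
    (trans (+-zero a) (sym (+-identityˡ a)))
    (λ b h → trans (+-suc a b) (trans (cong (_⊕ 𝟙) h) (sym (+-sucˡ b a))))

  +-assoc : ∀ a b c → (a ⊕ b) ⊕ c ≡ a ⊕ (b ⊕ c)
  +-assoc a b = Δ₀-IND (((v 1 `+ v 2) `+ v 0) `= (v 1 `+ (v 2 `+ v 0))) (a ∷ b ∷ []) []
    (trans (+-zero _) (cong (a ⊕_) (sym (+-zero b))))
    (λ c h → trans (+-suc _ c) (trans (cong (_⊕ 𝟙) h)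
               (trans (sym (+-suc a (b ⊕ c))) (cong (a ⊕_) (sym (+-suc b c))))))

  *-zeroˡ : ∀ a → 𝟘 ⊗ a ≡ 𝟘
  *-zeroˡ = Δ₀-IND ((`0 `* v 0) `= `0) [] []
    (*-zero 𝟘) (λ a h → trans (*-suc 𝟘 a) (trans (+-zero _) h))

  *-sucˡ : ∀ a b → (a ⊕ 𝟙) ⊗ b ≡ (a ⊗ b) ⊕ b
  *-sucˡ a = Δ₀-IND (((v 1 `+ `1) `* v 0) `= ((v 1 `* v 0) `+ v 0)) (a ∷ []) []
    (trans (*-zero _) (trans (sym (*-zero a)) (sym (+-zero _))))
    (λ b h → trans (*-suc _ b) (trans (cong (_⊕ (a ⊕ 𝟙)) h)
               (trans (middle-swap (a ⊗ b) b a) (cong (_⊕ (b ⊕ 𝟙)) (sym (*-suc a b))))))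
    where
    middle-swap : ∀ p b a → (p ⊕ b) ⊕ (a ⊕ 𝟙) ≡ (p ⊕ a) ⊕ (b ⊕ 𝟙)
    middle-swap p b a = trans (+-assoc p b _) (trans (cong (p ⊕_) (trans (+-suc b a)
      (trans (cong (_⊕ 𝟙) (+-comm b a)) (sym (+-suc a b))))) (sym (+-assoc p a _)))

  *-comm : ∀ a b → a ⊗ b ≡ b ⊗ a
  *-comm a = Δ₀-IND ((v 1 `* v 0) `= (v 0 `* v 1)) (a ∷ []) []
    (trans (*-zero a) (sym (*-zeroˡ a)))
    (λ b h → trans (*-suc a b) (trans (cong (_⊕ a) h) (sym (*-sucˡ b a))))

  *-distribˡ-+ : ∀ a b c → a ⊗ (b ⊕ c) ≡ (a ⊗ b) ⊕ (a ⊗ c)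
  *-distribˡ-+ a b = Δ₀-IND ((v 1 `* (v 2 `+ v 0)) `= ((v 1 `* v 2) `+ (v 1 `* v 0))) (a ∷ b ∷ []) []
    (trans (cong (a ⊗_) (+-zero b)) (trans (sym (+-zero _)) (cong ((a ⊗ b) ⊕_) (sym (*-zero a)))))
    (λ c h → trans (cong (a ⊗_) (+-suc b c)) (trans (*-suc a _) (trans (cong (_⊕ a) h)
               (trans (+-assoc _ _ _) (cong ((a ⊗ b) ⊕_) (sym (*-suc a c)))))))

  *-distribʳ-+ : ∀ a b c → (b ⊕ c) ⊗ a ≡ (b ⊗ a) ⊕ (c ⊗ a)
  *-distribʳ-+ a b c =
    trans (*-comm _ a) (trans (*-distribˡ-+ a b c) (cong₂ _⊕_ (*-comm a b) (*-comm a c)))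

  *-assoc : ∀ a b c → (a ⊗ b) ⊗ c ≡ a ⊗ (b ⊗ c)
  *-assoc a b = Δ₀-IND (((v 1 `* v 2) `* v 0) `= (v 1 `* (v 2 `* v 0))) (a ∷ b ∷ []) []
    (trans (*-zero _) (trans (sym (*-zero a)) (cong (a ⊗_) (sym (*-zero b)))))
    (λ c h → trans (*-suc _ c) (trans (cong (_⊕ (a ⊗ b)) h)
               (trans (sym (*-distribˡ-+ a _ _)) (cong (a ⊗_) (sym (*-suc b c))))))

  *-identityʳ : ∀ a → a ⊗ 𝟙 ≡ a
  *-identityʳ a = begin
    a ⊗ 𝟙          ≡⟨ cong (a ⊗_) (sym (+-identityˡ 𝟙)) ⟩
    a ⊗ (𝟘 ⊕ 𝟙)    ≡⟨ *-suc a 𝟘 ⟩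
    (a ⊗ 𝟘) ⊕ a    ≡⟨ cong (_⊕ a) (*-zero a) ⟩
    𝟘 ⊕ a          ≡⟨ +-identityˡ a ⟩
    a              ∎
    where open ≡-Reasoning

  commutativeSemiring : CommutativeSemiring 0ℓ 0ℓ
  commutativeSemiring = record
    { Carrier = Num ; _≈_ = _≡_ ; _+_ = _⊕_ ; _*_ = _⊗_ ; 0# = 𝟘 ; 1# = 𝟙
    ; isCommutativeSemiring = isCommutativeSemiringˡ record
      { +-isCommutativeMonoid = record
        { isMonoid = record
          { isSemigroup = record { isMagma = record { isEquivalence = isEquivalence ; ∙-cong = cong₂ _⊕_ }
                                 ; assoc = +-assoc }
          ; identity = +-identityˡ , +-zero }
        ; comm = +-comm }
      ; *-isCommutativeMonoid = record
        { isMonoid = record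
          { isSemigroup = record { isMagma = record { isEquivalence = isEquivalence ; ∙-cong = cong₂ _⊗_ }
                                 ; assoc = *-assoc }
          ; identity = (λ a → trans (*-comm 𝟙 a) (*-identityʳ a)) , *-identityʳ }
        ; comm = *-comm }
      ; distribʳ = *-distribʳ-+
      ; zeroˡ = *-zeroˡ } }

  open Solver commutativeSemiring using (solve; _:=_; _:+_; _:*_; con)

  +-cancelʳ-≡ : ∀ c a b → a ⊕ c ≡ b ⊕ c → a ≡ b
  +-cancelʳ-≡ c a b = Δ₀-IND (((v 1 `+ v 0) `= (v 2 `+ v 0)) `⇒ (v 1 `= v 2)) (a ∷ b ∷ []) []
    (λ h → trans (sym (+-zero a)) (trans h (+-zero b)))
    (λ c h e → h (succ-inj _ _ (trans (sym (+-suc a c)) (trans e (+-suc b c))))) c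

  +-cancelˡ-≡ : ∀ c a b → c ⊕ a ≡ c ⊕ b → a ≡ b
  +-cancelˡ-≡ c a b e = +-cancelʳ-≡ c a b (trans (+-comm a c) (trans e (+-comm c b)))

  zero-or-suc : ∀ a → a ≡ 𝟘 ⊎ Σ Num λ b → a ≡ b ⊕ 𝟙
  zero-or-suc a with Σ⁰₁-IND ((v 1 `= `0) `∨ (v 1 `= (v 0 `+ `1))) [] []
                       (𝟘 , inj₁ refl) (λ b _ → b , inj₂ refl) a
  ... | _ , inj₁ a≡0 = inj₁ a≡0
  ... | b , inj₂ a≡b+1 = inj₂ (b , a≡b+1)

  _≤_ _<_ : Num → Num → Set
  a ≤ b = Σ Num λ d → a ⊕ d ≡ b
  a < b = Σ Num λ d → (a ⊕ d) ⊕ 𝟙 ≡ b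

  <-irrefl : ∀ {a} → ¬ (a < a)
  <-irrefl {a} (d , e) = succ≢0 d (+-cancelʳ-≡ a (d ⊕ 𝟙) 𝟘 (begin
    (d ⊕ 𝟙) ⊕ a   ≡⟨ +-sucˡ d a ⟩
    (d ⊕ a) ⊕ 𝟙   ≡⟨ cong (_⊕ 𝟙) (+-comm d a) ⟩
    (a ⊕ d) ⊕ 𝟙   ≡⟨ e ⟩
    a             ≡⟨ sym (+-identityˡ a) ⟩
    𝟘 ⊕ a         ∎))
    where open ≡-Reasoning

  <-trichotomy : ∀ a b → a < b ⊎ a ≡ b ⊎ b < a
  <-trichotomy a b with Σ⁰₁-IND ((((v 2 `+ v 0) `+ `1) `= v 1) `∨ ((v 2 `= v 1) `∨ (((v 1 `+ v 0) `+ `1) `= v 2)))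
                                (a ∷ []) [] base step b
    where
    base : Σ Num λ d → ((a ⊕ d) ⊕ 𝟙 ≡ 𝟘) ⊎ (a ≡ 𝟘 ⊎ (𝟘 ⊕ d) ⊕ 𝟙 ≡ a)
    base with zero-or-suc a
    ... | inj₁ a≡0 = 𝟘 , inj₂ (inj₁ a≡0)
    ... | inj₂ (d , refl) = d , inj₂ (inj₂ (cong (_⊕ 𝟙) (+-identityˡ d)))
    step : ∀ b → (Σ Num λ d → ((a ⊕ d) ⊕ 𝟙 ≡ b) ⊎ (a ≡ b ⊎ (b ⊕ d) ⊕ 𝟙 ≡ a)) →
           Σ Num λ d → ((a ⊕ d) ⊕ 𝟙 ≡ b ⊕ 𝟙) ⊎ (a ≡ b ⊕ 𝟙 ⊎ ((b ⊕ 𝟙) ⊕ d) ⊕ 𝟙 ≡ a)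
    step b (d , inj₁ refl) = d ⊕ 𝟙 , inj₁ (cong (_⊕ 𝟙) (+-suc a d))
    step b (_ , inj₂ (inj₁ refl)) = 𝟘 , inj₁ (cong (_⊕ 𝟙) (+-zero a))
    step b (d , inj₂ (inj₂ refl)) with zero-or-suc d
    ... | inj₁ refl = 𝟘 , inj₂ (inj₁ (cong (_⊕ 𝟙) (+-zero b)))
    ... | inj₂ (d′ , refl) = d′ , inj₂ (inj₂ (cong (_⊕ 𝟙) (trans (+-sucˡ b d′) (sym (+-suc b d′)))))
  ... | d , inj₁ a<b = inj₁ (d , a<b)
  ... | _ , inj₂ (inj₁ a≡b) = inj₂ (inj₁ a≡b)
  ... | d , inj₂ (inj₂ b<a) = inj₂ (inj₂ (d , b<a))

  <⇒≺ : ∀ {a b} → a < b → a ≺ b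
  <⇒≺ {a} (d , refl) = Δ₀-IND (v 1 `< ((v 1 `+ v 0) `+ `1)) (a ∷ []) []
    (proj₂ (<-suc a (a ⊕ 𝟘)) (inj₂ (sym (+-zero a))))
    (λ d h → subst (λ c → a ≺ (c ⊕ 𝟙)) (sym (+-suc a d)) (proj₂ (<-suc a _) (inj₁ h))) d

  ≺-suc : ∀ a → a ≺ (a ⊕ 𝟙)
  ≺-suc a = proj₂ (<-suc a a) (inj₂ refl)

  ≺-+-sucˡ : ∀ a b → a ≺ ((a ⊕ b) ⊕ 𝟙)
  ≺-+-sucˡ a b = <⇒≺ (b , refl)

  ≺-+-sucʳ : ∀ a b → b ≺ ((a ⊕ b) ⊕ 𝟙)
  ≺-+-sucʳ a b = <⇒≺ (a , cong (_⊕ 𝟙) (+-comm b a))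

  ≤⇒≺suc : ∀ {a b} → a ≤ b → a ≺ (b ⊕ 𝟙)
  ≤⇒≺suc (d , a+d≡b) = <⇒≺ (d , cong (_⊕ 𝟙) a+d≡b)

  ≤-⟨,⟩ˡ : ∀ a b → a ≤ ⟨ a , b ⟩
  ≤-⟨,⟩ˡ a b = _ , +-comm a _

  ≤-⟨,⟩ʳ : ∀ a b → b ≤ ⟨ a , b ⟩
  ≤-⟨,⟩ʳ a b with zero-or-suc b
  ... | inj₁ refl = ⟨ a , 𝟘 ⟩ , +-identityˡ _
  ... | inj₂ (c , refl) = ((((a ⊕ c) ⊕ 𝟙) ⊗ (a ⊕ c)) ⊕ a) ⊕ a , expand a c
    where
    expand : ∀ a c → (c ⊕ 𝟙) ⊕ (((((a ⊕ c) ⊕ 𝟙) ⊗ (a ⊕ c)) ⊕ a) ⊕ a) ≡ ⟨ a , c ⊕ 𝟙 ⟩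
    expand = solve 2 (λ a c → (c :+ con 1) :+ (((((a :+ c) :+ con 1) :* (a :+ c)) :+ a) :+ a)
                               := ((a :+ (c :+ con 1)) :* (a :+ (c :+ con 1))) :+ a) refl

  ⟨,⟩-mono-< : ∀ {a b c d} → (a ⊕ b) < (c ⊕ d) → ⟨ a , b ⟩ < ⟨ c , d ⟩
  ⟨,⟩-mono-< {a} {b} {c} (e , a+b+e+1≡c+d) =
    gap a b e c , trans (expand a b e c) (cong (λ s → (s ⊗ s) ⊕ c) a+b+e+1≡c+d)
    where
    gap : Num → Num → Num → Num → Num
    gap a b e c = (((b ⊕ (a ⊕ b)) ⊕ (e ⊗ e)) ⊕ (((a ⊕ b) ⊗ e) ⊕ ((a ⊕ b) ⊗ e))) ⊕ ((e ⊕ e) ⊕ c)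
    expand : ∀ a b e c → (⟨ a , b ⟩ ⊕ gap a b e c) ⊕ 𝟙 ≡
                         ((((a ⊕ b) ⊕ e) ⊕ 𝟙) ⊗ (((a ⊕ b) ⊕ e) ⊕ 𝟙)) ⊕ c
    expand = solve 4 (λ a b e c →
      ((((a :+ b) :* (a :+ b)) :+ a)
        :+ ((((b :+ (a :+ b)) :+ (e :* e)) :+ (((a :+ b) :* e) :+ ((a :+ b) :* e))) :+ ((e :+ e) :+ c)))
        :+ con 1
      := ((((a :+ b) :+ e) :+ con 1) :* (((a :+ b) :+ e) :+ con 1)) :+ c) refl

  ⟨,⟩-injective : ∀ {a b c d} → ⟨ a , b ⟩ ≡ ⟨ c , d ⟩ → a ≡ c × b ≡ d
  ⟨,⟩-injective {a} {b} {c} {d} e with <-trichotomy (a ⊕ b) (c ⊕ d)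
  ... | inj₁ lt = ⊥-elim (<-irrefl (subst (⟨ a , b ⟩ <_) (sym e) (⟨,⟩-mono-< lt)))
  ... | inj₂ (inj₂ gt) = ⊥-elim (<-irrefl (subst (⟨ c , d ⟩ <_) e (⟨,⟩-mono-< gt)))
  ... | inj₂ (inj₁ a+b≡c+d) = a≡c , +-cancelˡ-≡ a b d (trans a+b≡c+d (cong (_⊕ d) (sym a≡c)))
    where
    a≡c : a ≡ c
    a≡c = +-cancelˡ-≡ _ a c (trans e (cong (λ s → (s ⊗ s) ⊕ c) (sym a+b≡c+d)))

  -- Matchings

  Symmetric : Sets → Set
  Symmetric X = ∀ x y → ⟨ x , y ⟩ ∈ X → ⟨ y , x ⟩ ∈ X

  Maximal : Sets → Sets → Set
  Maximal E M = ¬ (Σ Sets λ M′ → IsMatching E M′ × M ⊊ᵥ M′)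

  IsUnion : Sets → Sets → Sets → Set
  IsUnion U X Y = ∀ z → z ∈ U ↔ (z ∈ X ⊎ z ∈ Y)

  IsDoubleton : Sets → Num → Num → Set
  IsDoubleton T a b = ∀ x → x ∈ T ↔ (x ≡ a ⊎ x ≡ b)

  IsEdge : Sets → Num → Num → Set
  IsEdge S a b = IsDoubleton S ⟨ a , b ⟩ ⟨ b , a ⟩

  IsRestriction : Sets → Sets → Sets → Set
  IsRestriction R M S = ∀ z → z ∈ R ↔ (z ∈ M × ∀ x y → z ≡ ⟨ x , y ⟩ → ¬ x ∈ S)

  union : ∀ X Y → Σ Sets λ U → IsUnion U X Y
  union X Y = Δ₀-CA ((v 0 `∈ (# 0)) `∨ (v 0 `∈ (# 1))) [] (X ∷ Y ∷ [])

  doubleton : ∀ a b → Σ Sets λ T → IsDoubleton T a b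
  doubleton a b = Δ₀-CA ((v 0 `= v 1) `∨ (v 0 `= v 2)) (a ∷ b ∷ []) []

  edge : ∀ a b → Σ Sets λ S → IsEdge S a b
  edge a b = doubleton ⟨ a , b ⟩ ⟨ b , a ⟩

  restriction : ∀ M S → Σ Sets λ R → IsRestriction R M S
  restriction M S with Δ₀-CA ((v 0 `∈ (# 0)) `∧ (`∀< (v 0 `+ `1) ∙ (`∀< (v 1 `+ `1) ∙
                               ((v 2 `= ⟨ v 1 , v 0 ⟩ᵗ) `⇒ (`¬ (v 1 `∈ (# 1))))))) [] (M ∷ S ∷ [])
  ... | R , R↔ = R , λ z → (λ z∈R → let (z∈M , off) = proj₁ (R↔ z) z∈R in
                                      z∈M , λ { x y refl →
                                        off x (≤⇒≺suc (≤-⟨,⟩ˡ x y)) y (≤⇒≺suc (≤-⟨,⟩ʳ x y)) refl }) ,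
                           (λ (z∈M , off) → proj₂ (R↔ z) (z∈M , λ x _ y _ → off x y))

  ∪-isMatching : ∀ {E M₁ M₂ U} → IsMatching E M₁ → IsMatching E M₂ →
                 (∀ x → Covered M₁ x → ¬ Covered M₂ x) → IsUnion U M₁ M₂ → IsMatching E U
  ∪-isMatching {E} {U = U} (⊆₁ , sym₁ , fun₁) (⊆₂ , sym₂ , fun₂) disjoint U↔ = ⊆E , symmetric , functional
    where
    ⊆E : ∀ z → z ∈ U → z ∈ E
    ⊆E z z∈U = Sum.[ ⊆₁ z , ⊆₂ z ] (proj₁ (U↔ z) z∈U)
    symmetric : Symmetric U
    symmetric x y xy∈U = proj₂ (U↔ _) (Sum.map (sym₁ x y) (sym₂ x y) (proj₁ (U↔ _) xy∈U))
    functional : ∀ x y y′ → ⟨ x , y ⟩ ∈ U → ⟨ x , y′ ⟩ ∈ U → y ≡ y′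
    functional x y y′ xy∈U xy′∈U with proj₁ (U↔ _) xy∈U | proj₁ (U↔ _) xy′∈U
    ... | inj₁ xy∈M₁ | inj₁ xy′∈M₁ = fun₁ x y y′ xy∈M₁ xy′∈M₁
    ... | inj₂ xy∈M₂ | inj₂ xy′∈M₂ = fun₂ x y y′ xy∈M₂ xy′∈M₂
    ... | inj₁ xy∈M₁ | inj₂ xy′∈M₂ = ⊥-elim (disjoint x (y , xy∈M₁) (y′ , xy′∈M₂))
    ... | inj₂ xy∈M₂ | inj₁ xy′∈M₁ = ⊥-elim (disjoint x (y′ , xy′∈M₁) (y , xy∈M₂))

  ∪-coveredˡ : ∀ {U X Y x} → IsUnion U X Y → Covered X x → Covered U x
  ∪-coveredˡ U↔ (y , xy∈X) = y , proj₂ (U↔ _) (inj₁ xy∈X)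

  ∪-coveredʳ : ∀ {U X Y x} → IsUnion U X Y → Covered Y x → Covered U x
  ∪-coveredʳ U↔ (y , xy∈Y) = y , proj₂ (U↔ _) (inj₂ xy∈Y)

  ∪-covered⁻ : ∀ {U X Y x} → IsUnion U X Y → Covered U x → Covered X x ⊎ Covered Y x
  ∪-covered⁻ U↔ (y , xy∈U) = Sum.map (y ,_) (y ,_) (proj₁ (U↔ _) xy∈U)

  edge-ends : ∀ {S a b x y} → IsEdge S a b → ⟨ x , y ⟩ ∈ S → (x ≡ a × y ≡ b) ⊎ (x ≡ b × y ≡ a)
  edge-ends S↔ xy∈S = Sum.map ⟨,⟩-injective ⟨,⟩-injective (proj₁ (S↔ _) xy∈S)

  edge-isMatching : ∀ {E S a b} → Symmetric E → ⟨ a , b ⟩ ∈ E → a ≢ b → IsEdge S a b → IsMatching E S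
  edge-isMatching {E} {S} {a} {b} E-sym ab∈E a≢b S↔ = ⊆E , symmetric , functional
    where
    ⊆E : ∀ z → z ∈ S → z ∈ E
    ⊆E z z∈S with proj₁ (S↔ z) z∈S
    ... | inj₁ refl = ab∈E
    ... | inj₂ refl = E-sym a b ab∈E
    symmetric : Symmetric S
    symmetric x y xy∈S with edge-ends S↔ xy∈S
    ... | inj₁ (refl , refl) = proj₂ (S↔ _) (inj₂ refl)
    ... | inj₂ (refl , refl) = proj₂ (S↔ _) (inj₁ refl)
    functional : ∀ x y y′ → ⟨ x , y ⟩ ∈ S → ⟨ x , y′ ⟩ ∈ S → y ≡ y′
    functional x y y′ xy∈S xy′∈S with edge-ends S↔ xy∈S | edge-ends S↔ xy′∈S
    ... | inj₁ (_ , refl) | inj₁ (_ , refl) = refl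
    ... | inj₂ (_ , refl) | inj₂ (_ , refl) = refl
    ... | inj₁ (refl , _) | inj₂ (x≡b , _) = ⊥-elim (a≢b x≡b)
    ... | inj₂ (refl , _) | inj₁ (x≡a , _) = ⊥-elim (a≢b (sym x≡a))

  edge-coversˡ : ∀ {S a b} → IsEdge S a b → Covered S a
  edge-coversˡ {b = b} S↔ = b , proj₂ (S↔ _) (inj₁ refl)

  edge-coversʳ : ∀ {S a b} → IsEdge S a b → Covered S b
  edge-coversʳ {a = a} S↔ = a , proj₂ (S↔ _) (inj₂ refl)

  edge-covered⁻ : ∀ {S a b x} → IsEdge S a b → Covered S x → x ≡ a ⊎ x ≡ b
  edge-covered⁻ S↔ (_ , xy∈S) = Sum.map proj₁ proj₁ (edge-ends S↔ xy∈S)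

  restriction-isMatching : ∀ {E M S R} → IsMatching E M → (∀ x y → ⟨ x , y ⟩ ∈ M → y ∈ S → x ∈ S) →
                           IsRestriction R M S → IsMatching E R
  restriction-isMatching {M = M} {S} {R} (⊆E , M-sym , M-fun) S-closed R↔ =
    (λ z → ⊆E z ∘ proj₁ ∘ proj₁ (R↔ z)) , symmetric , λ x y y′ h h′ → M-fun x y y′ (∈M h) (∈M h′)
    where
    ∈M : ∀ {z} → z ∈ R → z ∈ M
    ∈M = proj₁ ∘ proj₁ (R↔ _)
    symmetric : Symmetric R
    symmetric x y xy∈R = proj₂ (R↔ _) (M-sym x y (∈M xy∈R) , off)
      where
      off : ∀ y′ x′ → ⟨ y , x ⟩ ≡ ⟨ y′ , x′ ⟩ → ¬ y′ ∈ S
      off y′ x′ e with ⟨,⟩-injective e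
      ... | refl , refl = proj₂ (proj₁ (R↔ _) xy∈R) x y refl ∘ S-closed x y (∈M xy∈R)

  restriction-covers : ∀ {M S R x} → IsRestriction R M S → Covered M x → ¬ x ∈ S → Covered R x
  restriction-covers R↔ (y , xy∈M) x∉S =
    y , proj₂ (R↔ _) (xy∈M , λ _ _ e → subst (λ x → ¬ x ∈ _) (proj₁ (⟨,⟩-injective e)) x∉S)

  restriction-covered⁻ : ∀ {M S R x} → IsRestriction R M S → Covered R x → Covered M x × ¬ x ∈ S
  restriction-covered⁻ R↔ (y , xy∈R) = let (xy∈M , off) = proj₁ (R↔ _) xy∈R in (y , xy∈M) , off _ y refl

  edge-irreflexive : ∀ {V E a b} → IsGraph V E → ⟨ a , b ⟩ ∈ E → a ≢ b
  edge-irreflexive (ends , _) ab∈E with ends _ ab∈E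
  ... | x , y , e , _ , _ , x≢y with ⟨,⟩-injective e
  ... | refl , refl = x≢y

  add-edge : ∀ {V E M a b} → IsGraph V E → IsMatching E M → ⟨ a , b ⟩ ∈ E → ¬ Covered M a → ¬ Covered M b →
             Σ Sets λ M′ → IsMatching E M′ × (∀ x → Covered M′ x ↔ (Covered M x ⊎ (x ≡ a ⊎ x ≡ b)))
  add-edge {a = a} {b} G M-matching ab∈E a-free b-free with edge a b
  ... | S , S↔ with union _ S
  ... | M′ , M′↔ = M′ , ∪-isMatching M-matching S-matching disjoint M′↔ , λ x → covered⁻ , covers
    where
    S-matching : IsMatching _ S
    S-matching = edge-isMatching (proj₂ G) ab∈E (edge-irreflexive G ab∈E) S↔
    disjoint : ∀ x → Covered _ x → ¬ Covered S x
    disjoint x x-covered x∈S with edge-covered⁻ S↔ x∈S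
    ... | inj₁ refl = a-free x-covered
    ... | inj₂ refl = b-free x-covered
    covered⁻ : ∀ {x} → Covered M′ x → Covered _ x ⊎ (x ≡ a ⊎ x ≡ b)
    covered⁻ = Sum.map₂ (edge-covered⁻ S↔) ∘ ∪-covered⁻ M′↔
    covers : ∀ {x} → Covered _ x ⊎ (x ≡ a ⊎ x ≡ b) → Covered M′ x
    covers (inj₁ x-covered) = ∪-coveredˡ M′↔ x-covered
    covers (inj₂ (inj₁ refl)) = ∪-coveredʳ M′↔ (edge-coversˡ S↔)
    covers (inj₂ (inj₂ refl)) = ∪-coveredʳ M′↔ (edge-coversʳ S↔)

  remove-edge : ∀ {E M a b} → IsMatching E M → ⟨ a , b ⟩ ∈ M →
                Σ Sets λ M′ → IsMatching E M′ × (∀ x → Covered M′ x ↔ (Covered M x × x ≢ a × x ≢ b))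
  remove-edge {M = M} {a} {b} M-matching@(_ , M-sym , M-fun) ab∈M with doubleton a b
  ... | T , T↔ with restriction M T
  ... | M′ , M′↔ = M′ , restriction-isMatching M-matching T-closed M′↔ ,
                   λ x → covered⁻ , λ (x-covered , x≢a , x≢b) →
                           restriction-covers M′↔ x-covered (Sum.[ x≢a , x≢b ] ∘ proj₁ (T↔ x))
    where
    T-closed : ∀ x y → ⟨ x , y ⟩ ∈ M → y ∈ T → x ∈ T
    T-closed x y xy∈M y∈T with proj₁ (T↔ y) y∈T
    ... | inj₁ refl = proj₂ (T↔ x) (inj₂ (M-fun a x b (M-sym x a xy∈M) ab∈M))
    ... | inj₂ refl = proj₂ (T↔ x) (inj₁ (M-fun b x a (M-sym x b xy∈M) (M-sym a b ab∈M)))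
    covered⁻ : ∀ {x} → Covered M′ x → Covered M x × x ≢ a × x ≢ b
    covered⁻ {x} x-covered = let (x-covered-by-M , x∉T) = restriction-covered⁻ M′↔ x-covered
                             in x-covered-by-M , x∉T ∘ proj₂ (T↔ x) ∘ inj₁ , x∉T ∘ proj₂ (T↔ x) ∘ inj₂

  augment₁ : ∀ {V E M a b} → IsGraph V E → IsMatching E M → ⟨ a , b ⟩ ∈ E →
             ¬ Covered M a → ¬ Covered M b → ¬ Maximal E M
  augment₁ {a = a} G M-matching ab∈E a-free b-free M-maximal with add-edge G M-matching ab∈E a-free b-free
  ... | M′ , M′-matching , M′-covers =
    M-maximal (M′ , M′-matching , (λ x → proj₂ (M′-covers x) ∘ inj₁) ,
               a , proj₂ (M′-covers a) (inj₂ (inj₁ refl)) , a-free)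

  augment₃ : ExcludedMiddle 0ℓ → ∀ {V E M a b c d} → IsGraph V E → IsMatching E M →
             ⟨ a , b ⟩ ∈ M → ⟨ c , a ⟩ ∈ E → ⟨ b , d ⟩ ∈ E →
             ¬ Covered M c → ¬ Covered M d → c ≢ d → ¬ Maximal E M
  augment₃ lem {M = M} {a} {b} {c} {d} G M-matching@(⊆E , M-sym , _) ab∈M ca∈E bd∈E c-free d-free c≢d M-maximal
    with remove-edge M-matching ab∈M
  ... | M₀ , M₀-matching , M₀-covers with add-edge G M₀-matching ca∈E (c-free ∘ proj₁ ∘ proj₁ (M₀-covers c))
                                               (λ a-covered → proj₁ (proj₂ (proj₁ (M₀-covers a) a-covered)) refl)
  ... | M₁ , M₁-matching , M₁-covers with add-edge G M₁-matching bd∈E b-free₁ d-free₁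
    where
    b-free₁ : ¬ Covered M₁ b
    b-free₁ b-covered with proj₁ (M₁-covers b) b-covered
    ... | inj₁ b-covered₀ = proj₂ (proj₂ (proj₁ (M₀-covers b) b-covered₀)) refl
    ... | inj₂ (inj₁ refl) = c-free (a , M-sym a b ab∈M)
    ... | inj₂ (inj₂ refl) = edge-irreflexive G (⊆E _ ab∈M) refl
    d-free₁ : ¬ Covered M₁ d
    d-free₁ d-covered with proj₁ (M₁-covers d) d-covered
    ... | inj₁ d-covered₀ = d-free (proj₁ (proj₁ (M₀-covers d) d-covered₀))
    ... | inj₂ (inj₁ refl) = c≢d refl
    ... | inj₂ (inj₂ refl) = d-free (b , ab∈M)
  ... | M₂ , M₂-matching , M₂-covers =
    M-maximal (M₂ , M₂-matching , covers ,
               c , proj₂ (M₂-covers c) (inj₁ (proj₂ (M₁-covers c) (inj₂ (inj₁ refl)))) , c-free)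
    where
    covers : ∀ x → Covered M x → Covered M₂ x
    covers x x-covered with lem {x ≡ a} | lem {x ≡ b}
    ... | yes refl | _ = proj₂ (M₂-covers x) (inj₁ (proj₂ (M₁-covers x) (inj₂ (inj₂ refl))))
    ... | no _ | yes refl = proj₂ (M₂-covers x) (inj₂ (inj₁ refl))
    ... | no x≢a | no x≢b =
      proj₂ (M₂-covers x) (inj₁ (proj₂ (M₁-covers x) (inj₁ (proj₂ (M₀-covers x) (x-covered , x≢a , x≢b)))))

  -- Σ⁰₁ projections from MM

  numeral : ℕ → Num
  numeral zero = 𝟘
  numeral (suc k) = numeral k ⊕ 𝟙

  numeral-injective : ∀ {k l} → numeral k ≡ numeral l → k ≡ l
  numeral-injective {zero} {zero} _ = refl
  numeral-injective {zero} {suc l} e = ⊥-elim (succ≢0 _ (sym e))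
  numeral-injective {suc k} {zero} e = ⊥-elim (succ≢0 _ e)
  numeral-injective {suc k} {suc l} e = cong suc (numeral-injective (succ-inj _ _ e))

  tagged : ℕ → Num → Num
  tagged k a = ⟨ a , numeral k ⟩

  tags-differ : ∀ k l {a b} {k≢l : False (k ℕ.≟ l)} → tagged k a ≢ tagged l b
  tags-differ k l {k≢l = k≢l} = toWitnessFalse k≢l ∘ numeral-injective ∘ proj₂ ∘ ⟨,⟩-injective

  A B C D : Num → Num
  A = tagged 0
  B = tagged 1
  C = tagged 2
  D = tagged 3

  data Arc (X : Sets) : Num → Num → Set where
    AB : ∀ u → Arc X (A u) (B u)
    CA : ∀ {i u} → ⟨ i , u ⟩ ∈ X → Arc X (C ⟨ i , u ⟩) (A u)
    DB : ∀ {i u} → ⟨ i , u ⟩ ∈ X → Arc X (D ⟨ i , u ⟩) (B u)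

  Projected : Sets → Num → Set
  Projected X u = Σ Num λ i → ⟨ i , u ⟩ ∈ X

  Link : Sets → Num → Num → Set
  Link X x y = Arc X x y ⊎ Arc X y x

  numeralᵗ : ∀ {n} → ℕ → Term n
  numeralᵗ zero = `0
  numeralᵗ (suc k) = numeralᵗ k `+ `1

  taggedᵗ : ∀ {n} → ℕ → Term n → Term n
  taggedᵗ k t = ⟨ t , numeralᵗ k ⟩ᵗ

  arcᶠ : ∀ {n} → Fin n → Fin n → Δ₀ n 1
  arcᶠ x y =
    (`∃< (var x `+ `1) ∙ ((var (Fin.suc x) `= taggedᵗ 0 (v 0)) `∧ (var (Fin.suc y) `= taggedᵗ 1 (v 0)))) `∨
    (`∃< (var x `+ `1) ∙ (`∃< (v 0 `+ `1) ∙ (`∃< (v 1 `+ `1) ∙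
      ((v 2 `= ⟨ v 1 , v 0 ⟩ᵗ) `∧ ((v 2 `∈ (# 0)) `∧
       (((x′ `= taggedᵗ 2 (v 2)) `∧ (y′ `= taggedᵗ 0 (v 0))) `∨
        ((x′ `= taggedᵗ 3 (v 2)) `∧ (y′ `= taggedᵗ 1 (v 0)))))))))
    where
    x′ y′ : Term _
    x′ = var (Fin.suc (Fin.suc (Fin.suc x)))
    y′ = var (Fin.suc (Fin.suc (Fin.suc y)))

  gadgetᶠ : Δ₀ 1 1
  gadgetᶠ = `∃< (v 0 `+ `1) ∙ (`∃< (v 1 `+ `1) ∙
              ((v 2 `= ⟨ v 1 , v 0 ⟩ᵗ) `∧ (arcᶠ (# 1) (# 0) `∨ arcᶠ (# 0) (# 1))))

  arcᶠ-sound : ∀ {n X} (x y : Fin n) (ρ : Vec Num n) → ⟦ arcᶠ x y ⟧ ρ (X ∷ []) → Arc X (lookup ρ x) (lookup ρ y)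
  arcᶠ-sound x y ρ (inj₁ (u , _ , ex , ey)) = subst₂ (Arc _) (sym ex) (sym ey) (AB u)
  arcᶠ-sound x y ρ (inj₂ (p , _ , i , _ , u , _ , refl , p∈X , inj₁ (ex , ey))) = subst₂ (Arc _) (sym ex) (sym ey) (CA p∈X)
  arcᶠ-sound x y ρ (inj₂ (p , _ , i , _ , u , _ , refl , p∈X , inj₂ (ex , ey))) = subst₂ (Arc _) (sym ex) (sym ey) (DB p∈X)

  arcᶠ-complete : ∀ {n X} (x y : Fin n) (ρ : Vec Num n) → Arc X (lookup ρ x) (lookup ρ y) → ⟦ arcᶠ x y ⟧ ρ (X ∷ [])
  arcᶠ-complete {X = X} x y ρ arc = from arc refl refl
    where
    ≺tagged : ∀ {a c} k → tagged k a ≡ c → a ≺ (c ⊕ 𝟙)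
    ≺tagged k refl = ≤⇒≺suc (≤-⟨,⟩ˡ _ (numeral k))
    from : ∀ {a b} → Arc X a b → a ≡ lookup ρ x → b ≡ lookup ρ y → ⟦ arcᶠ x y ⟧ ρ (X ∷ [])
    from (AB u) ex ey = inj₁ (u , ≺tagged 0 ex , sym ex , sym ey)
    from (CA {i} {u} iu∈X) ex ey =
      inj₂ (⟨ i , u ⟩ , ≺tagged 2 ex , i , ≤⇒≺suc (≤-⟨,⟩ˡ i u) , u , ≤⇒≺suc (≤-⟨,⟩ʳ i u) ,
            refl , iu∈X , inj₁ (sym ex , sym ey))
    from (DB {i} {u} iu∈X) ex ey =
      inj₂ (⟨ i , u ⟩ , ≺tagged 3 ex , i , ≤⇒≺suc (≤-⟨,⟩ˡ i u) , u , ≤⇒≺suc (≤-⟨,⟩ʳ i u) ,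
            refl , iu∈X , inj₂ (sym ex , sym ey))

  arc-irreflexive : ∀ {X x y} → Arc X x y → x ≢ y
  arc-irreflexive (AB _) = tags-differ 0 1
  arc-irreflexive (CA _) = tags-differ 2 0
  arc-irreflexive (DB _) = tags-differ 3 1

  A-link : ∀ {X u y} → Link X (A u) y → y ≡ B u ⊎ Σ Num λ i → ⟨ i , u ⟩ ∈ X × y ≡ C ⟨ i , u ⟩
  A-link (inj₁ arc) = out arc refl
    where
    out : ∀ {X u x y} → Arc X x y → x ≡ A u → y ≡ B u ⊎ Σ Num λ i → ⟨ i , u ⟩ ∈ X × y ≡ C ⟨ i , u ⟩
    out (AB _) e with ⟨,⟩-injective e
    ... | refl , _ = inj₁ refl
    out (CA _) e = ⊥-elim (tags-differ 2 0 e)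
    out (DB _) e = ⊥-elim (tags-differ 3 0 e)
  A-link (inj₂ arc) = into arc refl
    where
    into : ∀ {X u x y} → Arc X y x → x ≡ A u → y ≡ B u ⊎ Σ Num λ i → ⟨ i , u ⟩ ∈ X × y ≡ C ⟨ i , u ⟩
    into (AB _) e = ⊥-elim (tags-differ 1 0 e)
    into (CA {i} iu∈X) e with ⟨,⟩-injective e
    ... | refl , _ = inj₂ (i , iu∈X , refl)
    into (DB _) e = ⊥-elim (tags-differ 1 0 e)

  B-link : ∀ {X u y} → Link X (B u) y → y ≡ A u ⊎ Σ Num λ i → ⟨ i , u ⟩ ∈ X × y ≡ D ⟨ i , u ⟩
  B-link (inj₁ arc) = out arc refl
    where
    out : ∀ {X u x y} → Arc X x y → x ≡ B u → y ≡ A u ⊎ Σ Num λ i → ⟨ i , u ⟩ ∈ X × y ≡ D ⟨ i , u ⟩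
    out (AB _) e = ⊥-elim (tags-differ 0 1 e)
    out (CA _) e = ⊥-elim (tags-differ 2 1 e)
    out (DB _) e = ⊥-elim (tags-differ 3 1 e)
  B-link (inj₂ arc) = into arc refl
    where
    into : ∀ {X u x y} → Arc X y x → x ≡ B u → y ≡ A u ⊎ Σ Num λ i → ⟨ i , u ⟩ ∈ X × y ≡ D ⟨ i , u ⟩
    into (AB _) e with ⟨,⟩-injective e
    ... | refl , _ = inj₁ refl
    into (CA _) e = ⊥-elim (tags-differ 0 1 e)
    into (DB {i} iu∈X) e with ⟨,⟩-injective e
    ... | refl , _ = inj₂ (i , iu∈X , refl)

  C-link : ∀ {X i u y} → Link X (C ⟨ i , u ⟩) y → y ≡ A u
  C-link (inj₁ arc) = out arc refl
    where
    out : ∀ {X i u x y} → Arc X x y → x ≡ C ⟨ i , u ⟩ → y ≡ A u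
    out (AB _) e = ⊥-elim (tags-differ 0 2 e)
    out (CA _) e with ⟨,⟩-injective (proj₁ (⟨,⟩-injective e))
    ... | _ , refl = refl
    out (DB _) e = ⊥-elim (tags-differ 3 2 e)
  C-link (inj₂ arc) = ⊥-elim (into arc refl)
    where
    into : ∀ {X a x y} → Arc X y x → x ≢ C a
    into (AB _) = tags-differ 1 2
    into (CA _) = tags-differ 0 2
    into (DB _) = tags-differ 1 2

  D-link : ∀ {X i u y} → Link X (D ⟨ i , u ⟩) y → y ≡ B u
  D-link (inj₁ arc) = out arc refl
    where
    out : ∀ {X i u x y} → Arc X x y → x ≡ D ⟨ i , u ⟩ → y ≡ B u
    out (AB _) e = ⊥-elim (tags-differ 0 3 e)
    out (CA _) e = ⊥-elim (tags-differ 2 3 e)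
    out (DB _) e with ⟨,⟩-injective (proj₁ (⟨,⟩-injective e))
    ... | _ , refl = refl
  D-link (inj₂ arc) = ⊥-elim (into arc refl)
    where
    into : ∀ {X a x y} → Arc X y x → x ≢ D a
    into (AB _) = tags-differ 1 3
    into (CA _) = tags-differ 0 3
    into (DB _) = tags-differ 1 3

  IsGadget : Sets → Sets → Set
  IsGadget X EK = ∀ z → z ∈ EK ↔ (Σ Num λ x → Σ Num λ y → z ≡ ⟨ x , y ⟩ × Link X x y)

  gadget : ∀ X → Σ Sets (IsGadget X)
  gadget X with Δ₀-CA gadgetᶠ [] (X ∷ [])
  ... | EK , EK↔ = EK , λ z → sound z ∘ proj₁ (EK↔ z) , proj₂ (EK↔ z) ∘ complete z
    where
    sound : ∀ z → ⟦ gadgetᶠ ⟧ (z ∷ []) (X ∷ []) → Σ Num λ x → Σ Num λ y → z ≡ ⟨ x , y ⟩ × Link X x y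
    sound z (x , _ , y , _ , e , link) =
      x , y , e , Sum.map (arcᶠ-sound (# 1) (# 0) (y ∷ x ∷ z ∷ [])) (arcᶠ-sound (# 0) (# 1) (y ∷ x ∷ z ∷ [])) link
    complete : ∀ z → (Σ Num λ x → Σ Num λ y → z ≡ ⟨ x , y ⟩ × Link X x y) → ⟦ gadgetᶠ ⟧ (z ∷ []) (X ∷ [])
    complete _ (x , y , refl , link) =
      x , ≤⇒≺suc (≤-⟨,⟩ˡ x y) , y , ≤⇒≺suc (≤-⟨,⟩ʳ x y) , refl ,
      Sum.map (arcᶠ-complete (# 1) (# 0) (y ∷ x ∷ ⟨ x , y ⟩ ∷ []))
              (arcᶠ-complete (# 0) (# 1) (y ∷ x ∷ ⟨ x , y ⟩ ∷ [])) link

  gadget-link : ∀ {X EK x y} → IsGadget X EK → ⟨ x , y ⟩ ∈ EK → Link X x y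
  gadget-link EK↔ xy∈EK with proj₁ (EK↔ _) xy∈EK
  ... | _ , _ , e , link with ⟨,⟩-injective e
  ... | refl , refl = link

  gadget-edge : ∀ {X EK x y} → IsGadget X EK → Link X x y → ⟨ x , y ⟩ ∈ EK
  gadget-edge EK↔ link = proj₂ (EK↔ _) (_ , _ , refl , link)

  gadget-isGraph : ∀ {X EK} → IsGadget X EK → Σ Sets λ V → IsGraph V EK
  gadget-isGraph {EK = EK} EK↔ with Δ₀-CA (`0 `= `0) [] []
  ... | V , V↔ = V , ends , λ x y → gadget-edge EK↔ ∘ Sum.swap ∘ gadget-link EK↔
    where
    ends : ∀ z → z ∈ EK → Σ Num λ x → Σ Num λ y → z ≡ ⟨ x , y ⟩ × x ∈ V × y ∈ V × x ≢ y
    ends z z∈EK with proj₁ (EK↔ z) z∈EK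
    ... | x , y , e , link =
      x , y , e , proj₂ (V↔ x) refl , proj₂ (V↔ y) refl , Sum.[ arc-irreflexive , (_∘ sym) ∘ arc-irreflexive ] link

  module _ (lem : ExcludedMiddle 0ℓ) where

    module MaximalGadgetMatching {X EK V MK : Sets} (EK↔ : IsGadget X EK) (G : IsGraph V EK)
                                 (MK-matching : IsMatching EK MK) (MK-maximal : Maximal EK MK) where

      link : ∀ {x y} → ⟨ x , y ⟩ ∈ MK → Link X x y
      link = gadget-link EK↔ ∘ proj₁ MK-matching _

      MK-sym : Symmetric MK
      MK-sym = proj₁ (proj₂ MK-matching)

      MK-fun : ∀ x y y′ → ⟨ x , y ⟩ ∈ MK → ⟨ x , y′ ⟩ ∈ MK → y ≡ y′
      MK-fun = proj₂ (proj₂ MK-matching)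

      unmatched⇒projected : ∀ u → ¬ ⟨ A u , B u ⟩ ∈ MK → Projected X u
      unmatched⇒projected u AB∉MK with lem {Projected X u}
      ... | yes projected = projected
      ... | no unprojected = ⊥-elim (augment₁ G MK-matching (gadget-edge EK↔ (inj₁ (AB u))) A-free B-free MK-maximal)
        where
        A-free : ¬ Covered MK (A u)
        A-free (y , Ay∈MK) with A-link (link Ay∈MK)
        ... | inj₁ refl = AB∉MK Ay∈MK
        ... | inj₂ (i , iu∈X , _) = unprojected (i , iu∈X)
        B-free : ¬ Covered MK (B u)
        B-free (y , By∈MK) with B-link (link By∈MK)
        ... | inj₁ refl = AB∉MK (MK-sym _ _ By∈MK)
        ... | inj₂ (i , iu∈X , _) = unprojected (i , iu∈X)

      projected⇒unmatched : ∀ u → Projected X u → ¬ ⟨ A u , B u ⟩ ∈ MK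
      projected⇒unmatched u (i , iu∈X) AB∈MK =
        augment₃ lem G MK-matching AB∈MK (gadget-edge EK↔ (inj₁ (CA iu∈X))) (gadget-edge EK↔ (inj₂ (DB iu∈X)))
                 C-free D-free (tags-differ 2 3) MK-maximal
        where
        C-free : ¬ Covered MK (C ⟨ i , u ⟩)
        C-free (y , Cy∈MK) with C-link (link Cy∈MK)
        ... | refl = tags-differ 2 1 (MK-fun (A u) _ _ (MK-sym _ _ Cy∈MK) AB∈MK)
        D-free : ¬ Covered MK (D ⟨ i , u ⟩)
        D-free (y , Dy∈MK) with D-link (link Dy∈MK)
        ... | refl = tags-differ 3 0 (MK-fun (B u) _ _ (MK-sym _ _ Dy∈MK) (MK-sym _ _ AB∈MK))

    opaque
      projection : MM → ∀ X → Σ Sets λ R → ∀ u → u ∈ R ↔ Projected X u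
      projection mm X with gadget X
      ... | EK , EK↔ with gadget-isGraph EK↔
      ... | V , G with mm V EK G
      ... | MK , MK-matching , MK-maximal with Δ₀-CA (`¬ (⟨ taggedᵗ 0 (v 0) , taggedᵗ 1 (v 0) ⟩ᵗ `∈ (# 0))) [] (MK ∷ [])
      ... | R , R↔ = R , λ u → unmatched⇒projected u ∘ proj₁ (R↔ u) , proj₂ (R↔ u) ∘ projected⇒unmatched u
        where open MaximalGadgetMatching EK↔ G MK-matching MK-maximal

    -- Augmenting paths

    module AugmentingPath {V E M P : Sets} (M-matching : IsMatching E M)
                          (P-path : IsPath V E P) (P-augmenting : IsAugmenting M P) where

      Reaches : Num → Set
      Reaches i = Σ Num λ x → ⟨ i , x ⟩ ∈ P

      OnPath : Num → Set
      OnPath = Projected P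

      Step : Num → Num → Num → Set
      Step k x y = ⟨ k , x ⟩ ∈ P × ⟨ k ⊕ 𝟙 , y ⟩ ∈ P

      Consecutive : Num → Num → Set
      Consecutive x y = Σ Num λ k → Step k x y ⊎ Step k y x

      M-sym : Symmetric M
      M-sym = proj₁ (proj₂ M-matching)

      M-fun : ∀ x y y′ → ⟨ x , y ⟩ ∈ M → ⟨ x , y′ ⟩ ∈ M → y ≡ y′
      M-fun = proj₂ (proj₂ M-matching)

      P-fun : ∀ i x y → ⟨ i , x ⟩ ∈ P → ⟨ i , y ⟩ ∈ P → x ≡ y
      P-fun = proj₁ (proj₂ P-path)

      P-prefix : ∀ i x → ⟨ i ⊕ 𝟙 , x ⟩ ∈ P → Reaches i
      P-prefix = proj₁ (proj₂ (proj₂ P-path))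

      P-injective : ∀ i j x → ⟨ i , x ⟩ ∈ P → ⟨ j , x ⟩ ∈ P → i ≡ j
      P-injective = proj₁ (proj₂ (proj₂ (proj₂ P-path)))

      P-adjacent : ∀ i x y → ⟨ i , x ⟩ ∈ P → ⟨ i ⊕ 𝟙 , y ⟩ ∈ P → ⟨ x , y ⟩ ∈ E
      P-adjacent = proj₂ (proj₂ (proj₂ (proj₂ (proj₂ P-path))))

      start-free : ∀ x → ⟨ 𝟘 , x ⟩ ∈ P → ¬ Covered M x
      start-free = proj₁ P-augmenting

      alternating : ∀ i x y z → ⟨ i , x ⟩ ∈ P → ⟨ i ⊕ 𝟙 , y ⟩ ∈ P → ⟨ (i ⊕ 𝟙) ⊕ 𝟙 , z ⟩ ∈ P →
                    ⟨ x , y ⟩ ∈ M ↔ (¬ ⟨ y , z ⟩ ∈ M)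
      alternating = proj₁ (proj₂ P-augmenting)

      -- Induction on d for: t ∸ d is a position of P, or d exceeds t (the language has no ∸).
      reaches-≤ : ∀ {k t} → Reaches t → k ≤ t → Reaches k
      reaches-≤ {k} {t} (x , tx∈P) (d , k+d≡t) with Σ⁰₁-IND
          ((`∃< v 0 ∙ (`∃< v 1 ∙ (((v 1 `+ v 3) `= v 4) `∧ (⟨ v 1 , v 0 ⟩ᵗ `∈ (# 0))))) `∨
           (`∃< v 0 ∙ (((v 3 `+ v 0) `+ `1) `= v 2)))
          (t ∷ []) (P ∷ []) base step d
        where
        Descent : Num → Num → Set
        Descent w d = (Σ Num λ j → j ≺ w × Σ Num λ y → y ≺ w × ((j ⊕ d) ≡ t × ⟨ j , y ⟩ ∈ P)) ⊎
                      (Σ Num λ e → e ≺ w × ((t ⊕ e) ⊕ 𝟙) ≡ d)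
        base : Σ Num λ w → Descent w 𝟘
        base = (t ⊕ x) ⊕ 𝟙 , inj₁ (t , ≺-+-sucˡ t x , x , ≺-+-sucʳ t x , +-zero t , tx∈P)
        step : ∀ d → (Σ Num λ w → Descent w d) → Σ Num λ w → Descent w (d ⊕ 𝟙)
        step d (_ , inj₂ (e , _ , t+e+1≡d)) =
          (e ⊕ 𝟙) ⊕ 𝟙 , inj₂ (e ⊕ 𝟙 , ≺-suc _ , cong (_⊕ 𝟙) (trans (+-suc t e) t+e+1≡d))
        step d (_ , inj₁ (j , _ , y , _ , j+d≡t , jy∈P)) with zero-or-suc j
        ... | inj₁ refl = 𝟘 ⊕ 𝟙 , inj₂ (𝟘 , ≺-suc 𝟘 ,
                            cong (_⊕ 𝟙) (trans (+-zero t) (trans (sym j+d≡t) (+-identityˡ d))))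
        ... | inj₂ (j′ , refl) with P-prefix j′ y jy∈P
        ...   | y′ , j′y′∈P = (j′ ⊕ y′) ⊕ 𝟙 , inj₁ (j′ , ≺-+-sucˡ j′ y′ , y′ , ≺-+-sucʳ j′ y′ ,
                                trans (+-suc j′ d) (trans (sym (+-sucˡ j′ d)) j+d≡t) , j′y′∈P)
      ... | _ , inj₁ (j , _ , y , _ , j+d≡t , jy∈P) =
        y , subst (λ j → ⟨ j , y ⟩ ∈ P) (+-cancelʳ-≡ d j k (trans j+d≡t (sym k+d≡t))) jy∈P
      ... | _ , inj₂ (e , _ , t+e+1≡d) = ⊥-elim (<-irrefl (k ⊕ e , (begin
            (t ⊕ (k ⊕ e)) ⊕ 𝟙  ≡⟨ rearrange t k e ⟩
            k ⊕ ((t ⊕ e) ⊕ 𝟙)  ≡⟨ cong (k ⊕_) t+e+1≡d ⟩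
            k ⊕ d              ≡⟨ k+d≡t ⟩
            t                  ∎)))
        where
        open ≡-Reasoning
        rearrange : ∀ t k e → (t ⊕ (k ⊕ e)) ⊕ 𝟙 ≡ k ⊕ ((t ⊕ e) ⊕ 𝟙)
        rearrange = solve 3 (λ t k e → (t :+ (k :+ e)) :+ con 1 := k :+ ((t :+ e) :+ con 1)) refl

      proper⇒reaches-1 : IsProper M P → Reaches (𝟘 ⊕ 𝟙)
      proper⇒reaches-1 (i , _ , y , _ , i+1y∈P , _) =
        reaches-≤ (y , i+1y∈P) (i , trans (+-sucˡ 𝟘 i) (cong (_⊕ 𝟙) (+-identityˡ i)))

      covered⇒successor : ∀ {i x} → ⟨ i , x ⟩ ∈ P → Covered M x → Reaches (i ⊕ 𝟙)
      covered⇒successor {i} {x} ix∈P x-covered with proj₂ (proj₂ P-augmenting)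
      ... | inj₁ infinite = infinite (i ⊕ 𝟙)
      ... | inj₂ (k , z , kz∈P , k-last , z-free) with <-trichotomy i k
      ...   | inj₁ (d , i+d+1≡k) = reaches-≤ (z , kz∈P) (d , trans (+-sucˡ i d) i+d+1≡k)
      ...   | inj₂ (inj₁ refl) = ⊥-elim (z-free (subst (Covered M) (P-fun i x z ix∈P kz∈P) x-covered))
      ...   | inj₂ (inj₂ (d , k+d+1≡i)) = ⊥-elim (k-last (reaches-≤ (x , ix∈P) (d , trans (+-sucˡ k d) k+d+1≡i)))

      covered⇒predecessor : ∀ {i x} → ⟨ i , x ⟩ ∈ P → Covered M x → Σ Num λ j → i ≡ j ⊕ 𝟙
      covered⇒predecessor {i} ix∈P x-covered with zero-or-suc i
      ... | inj₁ refl = ⊥-elim (start-free _ ix∈P x-covered)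
      ... | inj₂ i≡j+1 = i≡j+1

      unmatched-neighbour : ∀ {i x} → ⟨ i , x ⟩ ∈ P → Covered M x → Σ Num λ y → ¬ ⟨ x , y ⟩ ∈ M × Consecutive x y
      unmatched-neighbour {x = x} ix∈P x-covered with covered⇒predecessor ix∈P x-covered
      ... | j , refl with P-prefix j x ix∈P
      ... | w , jw∈P with lem {⟨ w , x ⟩ ∈ M}
      ...   | no wx∉M = w , wx∉M ∘ M-sym x w , j , inj₂ (jw∈P , ix∈P)
      ...   | yes wx∈M with covered⇒successor ix∈P x-covered
      ...     | y , next∈P = y , proj₁ (alternating j w x y jw∈P ix∈P next∈P) wx∈M , j ⊕ 𝟙 , inj₁ (ix∈P , next∈P)

      partner-on-path : ∀ {i x y} → ⟨ i , y ⟩ ∈ P → ⟨ y , x ⟩ ∈ M → OnPath x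
      partner-on-path {x = x} {y} iy∈P yx∈M with covered⇒predecessor iy∈P (x , yx∈M)
      ... | j , refl with P-prefix j y iy∈P
      ... | w , jw∈P with lem {⟨ w , y ⟩ ∈ M}
      ...   | yes wy∈M = j , subst (λ x → ⟨ j , x ⟩ ∈ P) (M-fun y w x (M-sym w y wy∈M) yx∈M) jw∈P
      ...   | no wy∉M with covered⇒successor iy∈P (x , yx∈M)
      ...     | z , next∈P with lem {⟨ y , z ⟩ ∈ M}
      ...       | yes yz∈M = _ , subst (λ x → ⟨ _ , x ⟩ ∈ P) (M-fun y z x yz∈M yx∈M) next∈P
      ...       | no yz∉M = ⊥-elim (wy∉M (proj₂ (alternating j w y z jw∈P iy∈P next∈P) yz∉M))

      unmatched-neighbour-unique : ∀ {x y y′} → ¬ ⟨ x , y ⟩ ∈ M → Consecutive x y →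
                                   ¬ ⟨ x , y′ ⟩ ∈ M → Consecutive x y′ → y ≡ y′
      unmatched-neighbour-unique {x} {y} {y′} xy∉M (k , inj₁ (kx , k+1y)) xy′∉M (k′ , inj₁ (k′x , k′+1y′))
        with P-injective k k′ x kx k′x
      ... | refl = P-fun _ y y′ k+1y k′+1y′
      unmatched-neighbour-unique {x} {y} {y′} xy∉M (k , inj₁ (kx , k+1y)) xy′∉M (k′ , inj₂ (k′y′ , k′+1x))
        with P-injective k (k′ ⊕ 𝟙) x kx k′+1x
      ... | refl = ⊥-elim (xy′∉M (M-sym y′ x (proj₂ (alternating k′ y′ x y k′y′ k′+1x k+1y) xy∉M)))
      unmatched-neighbour-unique {x} {y} {y′} xy∉M (k , inj₂ (ky , k+1x)) xy′∉M (k′ , inj₁ (k′x , k′+1y′))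
        with P-injective k′ (k ⊕ 𝟙) x k′x k+1x
      ... | refl = ⊥-elim (xy∉M (M-sym y x (proj₂ (alternating k y x y′ ky k+1x k′+1y′) xy′∉M)))
      unmatched-neighbour-unique {x} {y} {y′} xy∉M (k , inj₂ (ky , k+1x)) xy′∉M (k′ , inj₂ (k′y′ , k′+1x))
        with succ-inj k k′ (P-injective _ _ x k+1x k′+1x)
      ... | refl = P-fun k y y′ ky k′y′

      IsUnmatchedPathEdges : Sets → Set
      IsUnmatchedPathEdges N = ∀ z → z ∈ N ↔
        (Σ Num λ x → Σ Num λ y → z ≡ ⟨ x , y ⟩ × ¬ ⟨ x , y ⟩ ∈ M × Consecutive x y)

      unmatchedPathEdges-covers : ∀ {N x y} → IsUnmatchedPathEdges N → ¬ ⟨ x , y ⟩ ∈ M → Consecutive x y → Covered N x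
      unmatchedPathEdges-covers {y = y} N↔ xy∉M xy-consecutive = y , proj₂ (N↔ _) (_ , _ , refl , xy∉M , xy-consecutive)

      unmatchedPathEdges-covered⁻ : ∀ {N x} → IsUnmatchedPathEdges N → Covered N x → OnPath x
      unmatchedPathEdges-covered⁻ N↔ (_ , xy∈N) with proj₁ (N↔ _) xy∈N
      ... | _ , _ , e , _ , k , step with ⟨,⟩-injective e
      ...   | refl , refl = Sum.[ (λ (kx , _) → k , kx) , (λ (_ , k+1x) → k ⊕ 𝟙 , k+1x) ] step

      unmatchedPathEdges-isMatching : ∀ {N} → Symmetric E → IsUnmatchedPathEdges N → IsMatching E N
      unmatchedPathEdges-isMatching {N} E-sym N↔ = ⊆E , symmetric , functional
        where
        edge-of : ∀ {x y} → ⟨ x , y ⟩ ∈ N → ¬ ⟨ x , y ⟩ ∈ M × Consecutive x y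
        edge-of xy∈N with proj₁ (N↔ _) xy∈N
        ... | _ , _ , e , xy∉M , xy-consecutive with ⟨,⟩-injective e
        ...   | refl , refl = xy∉M , xy-consecutive
        ⊆E : ∀ z → z ∈ N → z ∈ E
        ⊆E z z∈N with proj₁ (N↔ z) z∈N
        ... | x , y , refl , _ , k , inj₁ (kx , k+1y) = P-adjacent k x y kx k+1y
        ... | x , y , refl , _ , k , inj₂ (ky , k+1x) = E-sym y x (P-adjacent k y x ky k+1x)
        symmetric : Symmetric N
        symmetric x y xy∈N =
          let (xy∉M , k , step) = edge-of xy∈N in proj₂ (N↔ _) (y , x , refl , xy∉M ∘ M-sym y x , k , Sum.swap step)
        functional : ∀ x y y′ → ⟨ x , y ⟩ ∈ N → ⟨ x , y′ ⟩ ∈ N → y ≡ y′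
        functional x y y′ xy∈N xy′∈N =
          let (xy∉M , xy-consecutive) = edge-of xy∈N ; (xy′∉M , xy′-consecutive) = edge-of xy′∈N
          in unmatched-neighbour-unique xy∉M xy-consecutive xy′∉M xy′-consecutive

      unmatchedPairᶠ : Δ₀ 4 3 → Δ₀ 2 3
      unmatchedPairᶠ θ = `∃< (v 1 `+ `1) ∙ (`∃< (v 2 `+ `1) ∙
        ((v 3 `= ⟨ v 1 , v 0 ⟩ᵗ) `∧ ((`¬ (⟨ v 1 , v 0 ⟩ᵗ `∈ (# 1))) `∧ θ)))

      unmatchedPathEdgeᶠ : Σ⁰₁ 1 3
      unmatchedPathEdgeᶠ = unmatchedPairᶠ (`∃< v 2 ∙
        (((⟨ v 0 , v 2 ⟩ᵗ `∈ (# 0)) `∧ (⟨ v 0 `+ `1 , v 1 ⟩ᵗ `∈ (# 0))) `∨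
         ((⟨ v 0 , v 1 ⟩ᵗ `∈ (# 0)) `∧ (⟨ v 0 `+ `1 , v 2 ⟩ᵗ `∈ (# 0)))))

      -- Once the vertex set R of P is a set, being consecutive on P is also Π⁰₁: both ends lie on P
      -- and all their positions below any bound differ by one.
      unmatchedPathEdgeᶠ′ : Π⁰₁ 1 3
      unmatchedPathEdgeᶠ′ = unmatchedPairᶠ ((v 1 `∈ (# 2)) `∧ ((v 0 `∈ (# 2)) `∧ (`∀< v 2 ∙ (`∀< v 3 ∙
        (((⟨ v 1 , v 3 ⟩ᵗ `∈ (# 0)) `∧ (⟨ v 0 , v 2 ⟩ᵗ `∈ (# 0))) `⇒ ((v 0 `= (v 1 `+ `1)) `∨ (v 1 `= (v 0 `+ `1))))))))

      module _ {R : Sets} (R↔ : ∀ u → u ∈ R ↔ OnPath u) where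

        pathSets : Vec Sets 3
        pathSets = P ∷ M ∷ R ∷ []

        unmatchedPathEdgeᶠ⇒ᶠ′ : ∀ z → ⟦ unmatchedPathEdgeᶠ ⟧Σ (z ∷ []) pathSets →
                                ⟦ unmatchedPathEdgeᶠ′ ⟧Π (z ∷ []) pathSets
        unmatchedPathEdgeᶠ⇒ᶠ′ _ (_ , x , x≺ , y , y≺ , z≡xy , xy∉M , k , _ , inj₁ (kx , k+1y)) _ =
          x , x≺ , y , y≺ , z≡xy , xy∉M , proj₂ (R↔ x) (k , kx) , proj₂ (R↔ y) (_ , k+1y) ,
          λ i _ j _ (ix , jy) → inj₁ (trans (P-injective j _ y jy k+1y) (cong (_⊕ 𝟙) (P-injective k i x kx ix)))
        unmatchedPathEdgeᶠ⇒ᶠ′ _ (_ , x , x≺ , y , y≺ , z≡xy , xy∉M , k , _ , inj₂ (ky , k+1x)) _ =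
          x , x≺ , y , y≺ , z≡xy , xy∉M , proj₂ (R↔ x) (_ , k+1x) , proj₂ (R↔ y) (k , ky) ,
          λ i _ j _ (ix , jy) → inj₂ (trans (P-injective i _ x ix k+1x) (cong (_⊕ 𝟙) (P-injective k j y ky jy)))

        unmatchedPathEdgeᶠ′⇒ᶠ : ∀ z → ⟦ unmatchedPathEdgeᶠ′ ⟧Π (z ∷ []) pathSets →
                                ⟦ unmatchedPathEdgeᶠ ⟧Σ (z ∷ []) pathSets
        unmatchedPathEdgeᶠ′⇒ᶠ z for-all-w with for-all-w 𝟘
        ... | x , x≺ , y , y≺ , refl , xy∉M , x∈R , y∈R , _ with proj₁ (R↔ x) x∈R | proj₁ (R↔ y) y∈R
        ... | i , ix | j , jy with for-all-w ((i ⊕ j) ⊕ 𝟙)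
        ... | _ , _ , _ , _ , e , _ , _ , _ , positions-adjacent with ⟨,⟩-injective e
        ... | refl , refl with positions-adjacent i (≺-+-sucˡ i j) j (≺-+-sucʳ i j) (ix , jy)
        ...   | inj₁ refl = (i ⊕ j) ⊕ 𝟙 , x , x≺ , y , y≺ , refl , xy∉M , i , ≺-+-sucˡ i j , inj₁ (ix , jy)
        ...   | inj₂ refl = (i ⊕ j) ⊕ 𝟙 , x , x≺ , y , y≺ , refl , xy∉M , j , ≺-+-sucʳ i j , inj₂ (jy , ix)

        unmatchedPathEdges : Σ Sets IsUnmatchedPathEdges
        unmatchedPathEdges with Δ⁰₁-CA unmatchedPathEdgeᶠ unmatchedPathEdgeᶠ′ [] pathSets
                                       (λ z → unmatchedPathEdgeᶠ⇒ᶠ′ z , unmatchedPathEdgeᶠ′⇒ᶠ z)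
        ... | N , N↔ = N , λ z → sound z ∘ proj₁ (N↔ z) , proj₂ (N↔ z) ∘ complete z
          where
          sound : ∀ z → ⟦ unmatchedPathEdgeᶠ ⟧Σ (z ∷ []) pathSets →
                  Σ Num λ x → Σ Num λ y → z ≡ ⟨ x , y ⟩ × ¬ ⟨ x , y ⟩ ∈ M × Consecutive x y
          sound _ (_ , x , _ , y , _ , z≡xy , xy∉M , k , _ , step) = x , y , z≡xy , xy∉M , k , step
          complete : ∀ z → (Σ Num λ x → Σ Num λ y → z ≡ ⟨ x , y ⟩ × ¬ ⟨ x , y ⟩ ∈ M × Consecutive x y) →
                     ⟦ unmatchedPathEdgeᶠ ⟧Σ (z ∷ []) pathSets
          complete _ (x , y , refl , xy∉M , k , step) =
            k ⊕ 𝟙 , x , ≤⇒≺suc (≤-⟨,⟩ˡ x y) , y , ≤⇒≺suc (≤-⟨,⟩ʳ x y) , refl , xy∉M , k , ≺-suc k , step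

    maximal⇒independent : MM → ∀ {V E M} → IsGraph V E → IsMatching E M → Maximal E M → IsIndependent V E M
    maximal⇒independent mm {E = E} {M} G M-matching M-maximal (P , P-path , P-augmenting , P-proper , _)
      with projection mm P
    ... | R , R↔ with AugmentingPath.unmatchedPathEdges M-matching P-path P-augmenting R↔
    ... | N , N↔ with restriction M R
    ... | M₀ , M₀↔ with union N M₀
    ... | M′ , M′↔ = M-maximal (M′ , M′-matching , covers , x₀ , x₀-covered , start-free x₀ 0x₀∈P)
      where
      open AugmentingPath M-matching P-path P-augmenting
      M₀-matching : IsMatching E M₀
      M₀-matching = restriction-isMatching M-matching
        (λ x y xy∈M y∈R → proj₂ (R↔ x) (partner-on-path (proj₂ (proj₁ (R↔ y) y∈R)) (M-sym x y xy∈M))) M₀↔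
      disjoint : ∀ x → Covered N x → ¬ Covered M₀ x
      disjoint x x-in-N x-in-M₀ =
        proj₂ (restriction-covered⁻ M₀↔ x-in-M₀) (proj₂ (R↔ x) (unmatchedPathEdges-covered⁻ N↔ x-in-N))
      M′-matching : IsMatching E M′
      M′-matching = ∪-isMatching (unmatchedPathEdges-isMatching (proj₂ G) N↔) M₀-matching disjoint M′↔
      covers : ∀ x → Covered M x → Covered M′ x
      covers x x-covered with lem {x ∈ R}
      ... | no x∉R = ∪-coveredʳ M′↔ (restriction-covers M₀↔ x-covered x∉R)
      ... | yes x∈R with unmatched-neighbour (proj₂ (proj₁ (R↔ x) x∈R)) x-covered
      ...   | _ , xy∉M , xy-consecutive = ∪-coveredˡ M′↔ (unmatchedPathEdges-covers N↔ xy∉M xy-consecutive)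
      x₀ : Num
      x₀ = proj₁ (proj₁ P-path)
      0x₀∈P : ⟨ 𝟘 , x₀ ⟩ ∈ P
      0x₀∈P = proj₂ (proj₁ P-path)
      x₀-covered : Covered M′ x₀
      x₀-covered with proper⇒reaches-1 P-proper
      ... | x₁ , 1x₁∈P =
        ∪-coveredˡ M′↔ (unmatchedPathEdges-covers N↔ (start-free x₀ 0x₀∈P ∘ (x₁ ,_)) (𝟘 , inj₁ (0x₀∈P , 1x₁∈P)))

mainTheorem15 : ExcludedMiddle 0ℓ → (𝔐 : Structure) →
    Semantics.IsRCA₀ 𝔐 → Semantics.MM 𝔐 → Semantics.MIM 𝔐
mainTheorem15 lem 𝔐 rca mm V E G with mm V E G
... | M , M-matching , M-maximal =
  M , M-matching , maximal⇒independent rca lem mm G M-matching M-maximal ,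
  λ (M′ , M′-matching , _ , M⊊M′) → M-maximal (M′ , M′-matching , M⊊M′)
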